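{- Let $p$ be a prime and $n\ge2$, $e\ge1$ integers. Then \[g_n(p^e)\geq \sum_{j=1}^{\lfloor e/n\rfloor} p^{(n-2)j}\left( \binom{e-1-nj}{n-2}-\binom{e-1-n(j+1)}{n-2}\right).\]
   Context: $\mathbb{Z}^n$ denotes the ring of integer $n$-tuples with componentwise operations. A subring of $\mathbb{Z}^n$ is a finite-index additive subgroup containing $(1,\dots,1)$ and closed under componentwise multiplication; it is irreducible if for every vector $(x_1,\dots,x_n)$ in it, $x_1\equiv\cdots\equiv x_n\pmod p$. $g_n(p^e)$ is the number of irreducible subrings of $\mathbb{Z}^n$ of index $p^e$. Binomial coefficients $\binom{a}{b}$ with $a<b$ (including negative $a$) are interpreted as $0$. -}

module Defs where

import Data.Nat
open import Data.Nat using (ℕ; zero; suc) renaming (_+_ to _+ℕ_; _*_ to _*ℕ_; _^_ to _^ℕ_; _/_ to _/ℕ_)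
open import Data.Nat.Combinatorics using (_C_)
open import Data.Integer using (ℤ; +_; -[1+_]; _+_; _-_; _*_; -_)
open import Data.Integer.Divisibility using (_∣_)
open import Data.Fin using (Fin)
open import Data.Bool using (Bool; true)
open import Data.Product using (Σ; ∃; _×_)
open import Data.List using (List; upTo; map; foldr)
open import Relation.Binary.PropositionalEquality using (_≡_)
open import Relation.Nullary using (¬_)

Vecℤ : ℕ → Set
Vecℤ n = Fin n → ℤ

0ᵛ : ∀ {n} → Vecℤ n
0ᵛ _ = + 0

1ᵛ : ∀ {n} → Vecℤ n
1ᵛ _ = + 1

_+ᵛ_ : ∀ {n} → Vecℤ n → Vecℤ n → Vecℤ n
(x +ᵛ y) i = x i + y i

_-ᵛ_ : ∀ {n} → Vecℤ n → Vecℤ n → Vecℤ n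
(x -ᵛ y) i = x i - y i

-ᵛ_ : ∀ {n} → Vecℤ n → Vecℤ n
(-ᵛ x) i = - (x i)

_*ᵛ_ : ∀ {n} → Vecℤ n → Vecℤ n → Vecℤ n
(x *ᵛ y) i = x i * y i

Subsetℤ : ℕ → Set
Subsetℤ n = Vecℤ n → Bool

_∈ˢ_ : ∀ {n} → Vecℤ n → Subsetℤ n → Set
x ∈ˢ L = L x ≡ true

record IsSubringℤⁿ (n : ℕ) (L : Subsetℤ n) : Set where
  field
    zero-mem : 0ᵛ ∈ˢ L
    one-mem  : 1ᵛ ∈ˢ L
    +-closed : ∀ x y → x ∈ˢ L → y ∈ˢ L → (x +ᵛ y) ∈ˢ L
    neg-closed : ∀ x → x ∈ˢ L → (-ᵛ x) ∈ˢ L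
    *-closed : ∀ x y → x ∈ˢ L → y ∈ˢ L → (x *ᵛ y) ∈ˢ L

HasIndex : (n : ℕ) → Subsetℤ n → ℕ → Set
HasIndex n L k =
  Σ (Fin k → Vecℤ n) λ r →
    (∀ x → ∃ λ i → (x -ᵛ r i) ∈ˢ L) ×
    (∀ i j → (r i -ᵛ r j) ∈ˢ L → i ≡ j)

IsIrreducible : (n : ℕ) → ℕ → Subsetℤ n → Set
IsIrreducible n p L = ∀ x → x ∈ˢ L → ∀ i j → (+ p) ∣ (x i - x j)

IrredSubringOfIndex : (n p k : ℕ) → Subsetℤ n → Set
IrredSubringOfIndex n p k L =
  IsSubringℤⁿ n L × HasIndex n L k × IsIrreducible n p L

Distinct : ∀ {n} → Subsetℤ n → Subsetℤ n → Set
Distinct L L′ = ¬ (∀ x → L x ≡ L′ x)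

-- Binomial coefficient with integer top, equal to 0 when the top is negative
-- (and, via stdlib's _C_, also 0 when the top is smaller than the bottom).
binomℤ : ℤ → ℕ → ℕ
binomℤ (+ a) b = a C b
binomℤ -[1+ _ ] b = 0

term : (p n e j : ℕ) → ℤ
term p n e j =
  + (p ^ℕ ((n Data.Nat.∸ 2) *ℕ j)) *
    (+ binomℤ (+ e - + 1 - + (n *ℕ j)) (n Data.Nat.∸ 2)
     - + binomℤ (+ e - + 1 - + (n *ℕ suc j)) (n Data.Nat.∸ 2))

-- ∑_{j=1}^{⌊e/n⌋} term p n e j   (upTo m = [0, …, m-1], shifted by 1)
-- (n = 0 never occurs in the theorem since n ≥ 2; it is set to 0 there.)
lowerBound : (p n e : ℕ) → ℤ
lowerBound p zero e = + 0
lowerBound p (suc m) e =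
  foldr _+_ (+ 0) (map (λ i → term p (suc m) e (suc i)) (upTo (e /ℕ suc m)))

-- Write n = r + 2. Fix a level j ≥ 1, exponents g, a₁, …, a_r with g + Σ aᵢ = e, g ≥ 2j + 1 and
-- aᵢ ≥ j + 1, and digits kᵢ < p^j. The vectors x with p^aᵢ ∣ x_{i+2} − x₀ and
-- p^g ∣ (x₁ − x₀) − p^(g−j) Σ kᵢ (x_{i+2} − x₀)/p^aᵢ form a sublattice of index p^e containing
-- (1, …, 1), all of whose vectors have coordinates congruent mod p; it is closed under products
-- because g ≤ 2(g − j) and g ≤ (g − j) + aᵢ. The lattice determines g and the aᵢ (through its
-- vectors p^g e₁ and p^aᵢ e_{i+2} + p^(g−j) kᵢ e₁), hence j once (g, a) is required not to dominate
-- the level-(j+1) bound, and then each kᵢ mod p^j. The exponent vectors of sum e dominating the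
-- level-j bound (2j+1, j+1, …, j+1) are counted by C(e−1−nj, n−2), so exactly
-- C(e−1−nj, n−2) − C(e−1−n(j+1), n−2) of them have level j, each with p^((n−2)j) choices of k.

module Submission where

open import Defs
open import Data.Nat using (ℕ; _≤_)
open import Data.Nat.Primality using (Prime)
open import Data.Integer using (+_) renaming (_≤_ to _≤ℤ_)
open import Data.List using (List; length)
open import Data.List.Relation.Unary.All using (All)
open import Data.List.Relation.Unary.AllPairs using (AllPairs)
open import Data.Product using (Σ; _×_)

open import Data.Bool using (true; false; if_then_else_)
open import Data.Fin as Fin using (Fin; toℕ; punchIn)
import Data.Fin.Properties as Finₚ
open import Data.Integer using (ℤ; _+_; _-_; _*_; -_; ∣_∣; 0ℤ; 1ℤ; -1ℤ; _⊖_; _/ℕ_; _%ℕ_)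
open import Data.Integer.DivMod using (n%ℕd<d; a≡a%ℕn+[a/ℕn]*n)
open import Data.Integer.Divisibility.Signed
  using (_∣_; _∣?_; divides; quotient; *-cancelˡ-∣; ∣⇒∣ᵤ; ∣m∣n⇒∣m+n; ∣m∣n⇒∣m-n; ∣m⇒∣-m; ∣m⇒∣m*n; ∣n⇒∣m*n; ∣-trans)
import Data.Integer.Properties as ℤₚ
open import Data.Integer.Tactic.RingSolver using (solve-∀)
open import Data.List using ([]; _∷_; _++_; map; filter; foldr; concatMap; cartesianProduct; cartesianProductWith; upTo)
open import Data.List.Membership.Propositional using (_∈_)
open import Data.List.Membership.Propositional.Properties
  using (∈-++⁻; ∈-++⁺ˡ; ∈-++⁺ʳ; ∈-map⁻; ∈-map⁺; ∈-filter⁻; ∈-filter⁺; ∈-upTo⁻; ∈-cartesianProductWith⁻; ∈-cartesianProduct⁻)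
open import Data.List.Membership.Propositional.Properties.WithK using (unique∧set⇒bag)
import Data.List.Properties as Listₚ
open import Data.List.Relation.Binary.BagAndSetEquality using (∼bag⇒↭)
open import Data.List.Relation.Binary.Permutation.Propositional.Properties using (↭-length)
open import Data.List.Relation.Unary.All as All using ([]; _∷_)
import Data.List.Relation.Unary.All.Properties as Allₚ
open import Data.List.Relation.Unary.AllPairs using ([]; _∷_)
import Data.List.Relation.Unary.AllPairs.Properties as AllPairsₚ
open import Data.List.Relation.Unary.Any using (here; there)
open import Data.List.Relation.Unary.Unique.Propositional using (Unique)
import Data.List.Relation.Unary.Unique.Propositional.Properties as Uniqueₚ
open import Data.Nat as ℕ using (zero; suc; _∸_; _<_; z≤n; s≤s; NonZero; _/_)
  renaming (_+_ to _+ℕ_; _*_ to _*ℕ_; _^_ to _^ℕ_)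
open import Data.Nat.Combinatorics using (_C_; nCn≡1; nCk+nC[k+1]≡[n+1]C[k+1]; k>n⇒nCk≡0)
import Data.Nat.Divisibility as ℕ∣
open import Data.Nat.Primality using (prime⇒nonTrivial)
import Data.Nat.Properties as ℕₚ
open import Data.Nat.Tactic.RingSolver using () renaming (solve-∀ to ℕsolve-∀)
open import Data.Product using (_,_; proj₁; proj₂; ∃; map₂)
open import Data.Product.Function.NonDependent.Propositional using (_×-↔_)
open import Data.Sum using (inj₁; inj₂)
open import Data.Unit using (⊤; tt)
open import Data.Vec as Vec using (Vec; []; _∷_)
import Data.Vec.Properties as Vecₚ
open import Data.Vec.Relation.Binary.Pointwise.Inductive as Pointwise using (Pointwise; []; _∷_)
open import Function using (_∘_; _⇔_; _↔_; Inverse; mk⇔)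
open import Function.Properties.Inverse using (↔-refl; ↔-trans)
open import Relation.Binary using (tri<; tri≈; tri>)
open import Relation.Binary.PropositionalEquality
open import Relation.Nullary using (¬_; Dec; yes; no; does; contradiction)
open import Relation.Nullary.Decidable using (dec-true; dec-false)
open import Relation.Unary using (Decidable)
open import Relation.Unary.Properties using (∁?)

open import Algebra.Properties.Monoid.Sum ℕₚ.*-1-monoid using () renaming (sum to ∏)
open import Algebra.Properties.Semiring.Sum ℤₚ.+-*-semiring
  using (sum-syntax; ∑-distrib-+; *-distribˡ-sum; sum-cong-≗; sum-replicate-zero; sum-remove)
  renaming (sum to ∑)

private
  variable
    A B : Set

unique∧set⇒length≡ : {xs ys : List A} → Unique xs → Unique ys →
                     (∀ {x} → x ∈ xs ⇔ x ∈ ys) → length xs ≡ length ys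
unique∧set⇒length≡ xs! ys! xs≈ys = ↭-length (∼bag⇒↭ (unique∧set⇒bag xs! ys! xs≈ys))

module _ {Q : A → Set} (Q? : Decidable Q) where

  length-filter-split : ∀ xs → length (filter (∁? Q?) xs) +ℕ length (filter Q? xs) ≡ length xs
  length-filter-split [] = refl
  length-filter-split (x ∷ xs) with does (Q? x)
  ... | true  = trans (ℕₚ.+-suc _ _) (cong suc (length-filter-split xs))
  ... | false = cong suc (length-filter-split xs)

  filter-filter-⊆ : ∀ {P : A → Set} (P? : Decidable P) → (∀ {x} → Q x → P x) →
                    ∀ xs → filter Q? (filter P? xs) ≡ filter Q? xs
  filter-filter-⊆ P? Q⊆P [] = refl
  filter-filter-⊆ P? Q⊆P (x ∷ xs) with P? x
  ... | no ¬px = trans (filter-filter-⊆ P? Q⊆P xs) (sym (Listₚ.filter-reject Q? (¬px ∘ Q⊆P)))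
  ... | yes _ with Q? x
  ...   | yes _ = cong (x ∷_) (filter-filter-⊆ P? Q⊆P xs)
  ...   | no _  = filter-filter-⊆ P? Q⊆P xs

length-cartesianProductWith : ∀ {C : Set} (f : A → B → C) xs ys →
                              length (cartesianProductWith f xs ys) ≡ length xs *ℕ length ys
length-cartesianProductWith f []       ys = refl
length-cartesianProductWith f (x ∷ xs) ys = begin
  length (map (f x) ys ++ cartesianProductWith f xs ys)          ≡⟨ Listₚ.length-++ (map (f x) ys) ⟩
  length (map (f x) ys) +ℕ length (cartesianProductWith f xs ys) ≡⟨ cong₂ _+ℕ_ (Listₚ.length-map (f x) ys)
                                                                          (length-cartesianProductWith f xs ys) ⟩
  length ys +ℕ length xs *ℕ length ys                            ∎
  where open ≡-Reasoning

module _ {C : A → Set} (f : (x : A) → List (C x)) where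

  tagged : List A → List (Σ A C)
  tagged = concatMap (λ x → map (x ,_) (f x))

  ∈-tagged⁻ : ∀ {xs v} → v ∈ tagged xs → proj₁ v ∈ xs
  ∈-tagged⁻ {x ∷ xs} v∈ with ∈-++⁻ (map (x ,_) (f x)) v∈
  ... | inj₁ v∈fx = let (_ , _ , v≡) = ∈-map⁻ (x ,_) v∈fx in here (cong proj₁ v≡)
  ... | inj₂ v∈rest = there (∈-tagged⁻ v∈rest)

  tagged-unique : ∀ {xs} → Unique xs → (∀ x → Unique (f x)) → Unique (tagged xs)
  tagged-unique [] f! = []
  tagged-unique {x ∷ xs} (x∉xs ∷ xs!) f! =
    Uniqueₚ.++⁺ (Uniqueₚ.map⁺ tag-injective (f! x)) (tagged-unique xs! f!) disjoint
    where
    tag-injective : ∀ {c c'} → (x , c) ≡ (x , c') → c ≡ c'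
    tag-injective refl = refl
    disjoint : ∀ {v} → ¬ (v ∈ map (x ,_) (f x) × v ∈ tagged xs)
    disjoint (v∈fx , v∈rest) with ∈-map⁻ (x ,_) v∈fx
    ... | _ , _ , refl = Allₚ.All¬⇒¬Any x∉xs (∈-tagged⁻ v∈rest)

pairs-of-unique : ∀ {V : A → Set} {R : A → A → Set} → (∀ {x y} → V x → V y → x ≢ y → R x y) →
                  ∀ {xs} → All V xs → Unique xs → AllPairs R xs
pairs-of-unique R⁺ [] [] = []
pairs-of-unique R⁺ (vx ∷ vxs) (x∉xs ∷ xs!) =
  All.zipWith (λ (vy , x≢y) → R⁺ vx vy x≢y) (vxs , x∉xs) ∷ pairs-of-unique R⁺ vxs xs!

dec-true⁻¹ : ∀ {P : Set} (P? : Dec P) → does P? ≡ true → P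
dec-true⁻¹ (yes p) _ = p

lookup-ext : ∀ {m} {a a' : Vec A m} → (∀ i → Vec.lookup a i ≡ Vec.lookup a' i) → a ≡ a'
lookup-ext {a = a} {a'} a≗a' = trans (sym (Vecₚ.tabulate∘lookup a)) (trans (Vecₚ.tabulate-cong a≗a') (Vecₚ.tabulate∘lookup a'))

∣∧<⇒≡0 : ∀ {m n} → m ℕ∣.∣ n → n < m → n ≡ 0
∣∧<⇒≡0 {n = zero}  _   _   = refl
∣∧<⇒≡0 {n = suc _} m∣n n<m = contradiction (ℕ∣.∣⇒≤ m∣n) (ℕₚ.<⇒≱ n<m)

∣-<⇒≡ : ∀ {N a b} → a < N → b < N → + N ∣ + a - + b → a ≡ b
∣-<⇒≡ {N} {a} {b} a<N b<N N∣a-b = ℤₚ.+-injective (ℤₚ.i-j≡0⇒i≡j (+ a) (+ b) (ℤₚ.∣i∣≡0⇒i≡0 ∣a-b∣≡0))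
  where
  ∣a-b∣<N : ∣ + a - + b ∣ < N
  ∣a-b∣<N = begin-strict
    ∣ + a - + b ∣  ≡⟨ cong ∣_∣ (ℤₚ.m-n≡m⊖n a b) ⟩
    ∣ a ⊖ b ∣      ≤⟨ ℤₚ.∣m⊝n∣≤m⊔n a b ⟩
    a ℕ.⊔ b        <⟨ ℕₚ.⊔-lub a<N b<N ⟩
    N              ∎
    where open ℕₚ.≤-Reasoning
  ∣a-b∣≡0 = ∣∧<⇒≡0 (∣⇒∣ᵤ N∣a-b) ∣a-b∣<N

a-a%ℕd≡[a/ℕd]*d : ∀ a d .{{_ : NonZero d}} → a - + (a %ℕ d) ≡ (a /ℕ d) * + d
a-a%ℕd≡[a/ℕd]*d a d = begin
  a - + (a %ℕ d)                              ≡⟨ cong (λ b → b - + (a %ℕ d)) (a≡a%ℕn+[a/ℕn]*n a d) ⟩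
  + (a %ℕ d) + (a /ℕ d) * + d - + (a %ℕ d)    ≡⟨ identity (+ (a %ℕ d)) ((a /ℕ d) * + d) ⟩
  (a /ℕ d) * + d                              ∎
  where
  open ≡-Reasoning
  identity : ∀ m q → m + q - m ≡ q
  identity = solve-∀

∑-∣ : ∀ {r} {d : ℤ} (f : Fin r → ℤ) → (∀ i → d ∣ f i) → d ∣ ∑ f
∑-∣ {zero}  f d∣f = divides 0ℤ refl
∑-∣ {suc r} f d∣f = ∣m∣n⇒∣m+n (d∣f Fin.zero) (∑-∣ (f ∘ Fin.suc) (d∣f ∘ Fin.suc))

∑-zero : ∀ {r} (f : Fin r → ℤ) → (∀ i → f i ≡ 0ℤ) → ∑ f ≡ 0ℤ
∑-zero {r} f f≡0 = trans (sum-cong-≗ f≡0) (sum-replicate-zero r)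

unit : ∀ {r} → Fin r → Fin r → ℤ
unit i j = if does (i Finₚ.≟ j) then 1ℤ else 0ℤ

unit-diag : ∀ {r} (i : Fin r) → unit i i ≡ 1ℤ
unit-diag i rewrite dec-true (i Finₚ.≟ i) refl = refl

unit-off : ∀ {r} {i j : Fin r} → i ≢ j → unit i j ≡ 0ℤ
unit-off {i = i} {j} i≢j rewrite dec-false (i Finₚ.≟ j) i≢j = refl

∑-unit : ∀ {r} (f : Fin r → ℤ) (i : Fin r) → ∑[ j < r ] (f j * unit i j) ≡ f i
∑-unit {suc r} f i = begin
  ∑[ j < suc r ] (f j * unit i j)                        ≡⟨ sum-remove {i = i} (λ j → f j * unit i j) ⟩
  f i * unit i i + ∑[ j < r ] (f (punchIn i j) * unit i (punchIn i j))
    ≡⟨ cong₂ _+_ (cong (f i *_) (unit-diag i)) (∑-zero _ off-diagonal) ⟩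
  f i * 1ℤ + 0ℤ                                          ≡⟨ ℤₚ.+-identityʳ _ ⟩
  f i * 1ℤ                                               ≡⟨ ℤₚ.*-identityʳ (f i) ⟩
  f i                                                    ∎
  where
  open ≡-Reasoning
  off-diagonal : ∀ j → f (punchIn i j) * unit i (punchIn i j) ≡ 0ℤ
  off-diagonal j = trans (cong (f (punchIn i j) *_) (unit-off (Finₚ.punchInᵢ≢i i j ∘ sym))) (ℤₚ.*-zeroʳ (f (punchIn i j)))

-- The lattices L(G, A, D, k)

off : ∀ {n} → Vecℤ (suc n) → Fin (suc n) → ℤ
off x c = x c - x Fin.zero

module _ {n} (x y : Vecℤ (suc n)) (c : Fin (suc n)) where

  off-+ : off (x +ᵛ y) c ≡ off x c + off y c
  off-+ = identity (x c) (y c) (x Fin.zero) (y Fin.zero)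
    where identity : ∀ a b a₀ b₀ → a + b - (a₀ + b₀) ≡ a - a₀ + (b - b₀)
          identity = solve-∀

  off-- : off (x -ᵛ y) c ≡ off x c - off y c
  off-- = identity (x c) (y c) (x Fin.zero) (y Fin.zero)
    where identity : ∀ a b a₀ b₀ → a - b - (a₀ - b₀) ≡ a - a₀ - (b - b₀)
          identity = solve-∀

  off-* : off (x *ᵛ y) c ≡ x Fin.zero * off y c + y Fin.zero * off x c + off x c * off y c
  off-* = identity (x c) (y c) (x Fin.zero) (y Fin.zero)
    where identity : ∀ a b a₀ b₀ → a * b - a₀ * b₀ ≡ a₀ * (b - b₀) + b₀ * (a - a₀) + (a - a₀) * (b - b₀)
          identity = solve-∀

off-neg : ∀ {n} (x : Vecℤ (suc n)) c → off (-ᵛ x) c ≡ - off x c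
off-neg x c = identity (x c) (x Fin.zero)
  where identity : ∀ a a₀ → - a - (- a₀) ≡ - (a - a₀)
        identity = solve-∀

off-const : ∀ {n} (a : ℤ) (c : Fin (suc n)) → off {n} (λ _ → a) c ≡ 0ℤ
off-const a c = ℤₚ.+-inverseʳ a

cons₂ : ∀ {r} → ℤ → ℤ → (Fin r → ℤ) → Vecℤ (2 +ℕ r)
cons₂ x₀ x₁ xs Fin.zero                = x₀
cons₂ x₀ x₁ xs (Fin.suc Fin.zero)      = x₁
cons₂ x₀ x₁ xs (Fin.suc (Fin.suc i))   = xs i

off-cons₂ : ∀ {r} x₁ (xs : Fin r → ℤ) c → off (cons₂ 0ℤ x₁ xs) c ≡ cons₂ 0ℤ x₁ xs c
off-cons₂ x₁ xs c = ℤₚ.+-identityʳ (cons₂ 0ℤ x₁ xs c)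

off₁ : ∀ {r} → Vecℤ (2 +ℕ r) → ℤ
off₁ x = off x (Fin.suc Fin.zero)

off₂ : ∀ {r} → Vecℤ (2 +ℕ r) → Fin r → ℤ
off₂ x i = off x (Fin.suc (Fin.suc i))

Digits : ∀ {r} → (Fin r → ℕ) → Set
Digits {zero}  A = ⊤
Digits {suc r} A = Fin (A Fin.zero) × Digits (A ∘ Fin.suc)

Fin-∏↔Digits : ∀ {r} (A : Fin r → ℕ) → Fin (∏ A) ↔ Digits A
Fin-∏↔Digits {zero}  A = Finₚ.1↔⊤
Fin-∏↔Digits {suc r} A = ↔-trans Finₚ.*↔× (↔-refl ×-↔ Fin-∏↔Digits (A ∘ Fin.suc))

digit : ∀ {r} {A : Fin r → ℕ} → Digits A → (i : Fin r) → Fin (A i)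
digit (d , _)  Fin.zero    = d
digit (_ , ds) (Fin.suc i) = digit ds i

digits : ∀ {r} {A : Fin r → ℕ} → ((i : Fin r) → Fin (A i)) → Digits A
digits {zero}  f = tt
digits {suc r} f = f Fin.zero , digits (f ∘ Fin.suc)

digit-digits : ∀ {r} {A : Fin r → ℕ} (f : (i : Fin r) → Fin (A i)) i → digit (digits f) i ≡ f i
digit-digits f Fin.zero    = refl
digit-digits f (Fin.suc i) = digit-digits (f ∘ Fin.suc) i

digit-injective : ∀ {r} {A : Fin r → ℕ} {d d' : Digits A} → (∀ i → digit d i ≡ digit d' i) → d ≡ d'
digit-injective {zero}                           _  = refl
digit-injective {suc r} {d = _ , _} {d' = _ , _} eq = cong₂ _,_ (eq Fin.zero) (digit-injective (eq ∘ Fin.suc))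

hasIndex-via : ∀ {n k} {L : Subsetℤ n} {R : Set} → Fin k ↔ R → (ρ : R → Vecℤ n) →
               (∀ x → ∃ λ t → (x -ᵛ ρ t) ∈ˢ L) → (∀ t t' → (ρ t -ᵛ ρ t') ∈ˢ L → t ≡ t') →
               HasIndex n L k
hasIndex-via {L = L} Fin↔R ρ reduce separate = ρ ∘ to , complete , incongruent
  where
  open Inverse Fin↔R
  complete : ∀ x → ∃ λ i → (x -ᵛ ρ (to i)) ∈ˢ L
  complete x with reduce x
  ... | t , x-ρt∈L = from t , subst (λ t → (x -ᵛ ρ t) ∈ˢ L) (sym (strictlyInverseˡ t)) x-ρt∈L
  incongruent : ∀ i j → (ρ (to i) -ᵛ ρ (to j)) ∈ˢ L → i ≡ j
  incongruent i j ρi-ρj∈L = begin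
    i            ≡⟨ strictlyInverseʳ i ⟨
    from (to i)  ≡⟨ cong from (separate (to i) (to j) ρi-ρj∈L) ⟩
    from (to j)  ≡⟨ strictlyInverseʳ j ⟩
    j            ∎
    where open ≡-Reasoning

-- L(G, A, D, k) is spanned by (1, …, 1), G e₁ and the vectors A i e_{i+2} + D k i e₁: x is a
-- member iff A i ∣ x_{i+2} − x₀ with quotient quot i, and G ∣ (x₁ − x₀) − shear quot.
module Lattice {r} (G : ℕ) (A : Fin r → ℕ) (D : ℤ) (k : Fin r → ℤ) (A≢0 : ∀ i → NonZero (A i)) where

  shear : (Fin r → ℤ) → ℤ
  shear q = D * ∑[ i < r ] (k i * q i)

  shear-cong : ∀ {q q'} → (∀ i → q i ≡ q' i) → shear q ≡ shear q'
  shear-cong q≗q' = cong (D *_) (sum-cong-≗ (λ i → cong (k i *_) (q≗q' i)))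

  shear-zero : ∀ {q} → (∀ i → q i ≡ 0ℤ) → shear q ≡ 0ℤ
  shear-zero q≡0 = trans (cong (D *_) (∑-zero _ (λ i → trans (cong (k i *_) (q≡0 i)) (ℤₚ.*-zeroʳ (k i)))))
                         (ℤₚ.*-zeroʳ D)

  shear-+ : ∀ q q' → shear (λ i → q i + q' i) ≡ shear q + shear q'
  shear-+ q q' = begin
    D * ∑[ i < r ] (k i * (q i + q' i))              ≡⟨ cong (D *_) (sum-cong-≗ (λ i → ℤₚ.*-distribˡ-+ (k i) (q i) (q' i))) ⟩
    D * ∑[ i < r ] (k i * q i + k i * q' i)          ≡⟨ cong (D *_) (∑-distrib-+ (λ i → k i * q i) (λ i → k i * q' i)) ⟩
    D * (∑[ i < r ] (k i * q i) + ∑[ i < r ] (k i * q' i)) ≡⟨ ℤₚ.*-distribˡ-+ D _ _ ⟩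
    shear q + shear q'                              ∎
    where open ≡-Reasoning

  shear-*ˡ : ∀ c q → shear (λ i → c * q i) ≡ c * shear q
  shear-*ˡ c q = begin
    D * ∑[ i < r ] (k i * (c * q i))  ≡⟨ cong (D *_) (sum-cong-≗ (λ i → swap (k i) c (q i))) ⟩
    D * ∑[ i < r ] (c * (k i * q i))  ≡⟨ cong (D *_) (*-distribˡ-sum c (λ i → k i * q i)) ⟨
    D * (c * ∑[ i < r ] (k i * q i))  ≡⟨ swap D c (∑[ i < r ] (k i * q i)) ⟩
    c * shear q                       ∎
    where
    open ≡-Reasoning
    swap : ∀ a c b → a * (c * b) ≡ c * (a * b)
    swap = solve-∀

  record Member (x : Vecℤ (2 +ℕ r)) : Set where
    constructor member
    field
      quot         : Fin r → ℤ
      off₂≡        : ∀ i → off₂ x i ≡ quot i * + A i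
      G∣off₁-shear : + G ∣ off₁ x - shear quot

  open Member public

  quot-unique : ∀ {x} (m : Member x) (A∣ : ∀ i → + A i ∣ off₂ x i) → ∀ i → quot m i ≡ quotient (A∣ i)
  quot-unique m A∣ i = ℤₚ.*-cancelʳ-≡ _ _ (+ A i) {{A≢0 i}} (trans (sym (off₂≡ m i)) (_∣_.equality (A∣ i)))

  member? : ∀ x → Dec (Member x)
  member? x with Finₚ.all? (λ i → + A i ∣? off₂ x i)
  ... | no ¬A∣ = no λ m → ¬A∣ (λ i → divides (quot m i) (off₂≡ m i))
  ... | yes A∣ with + G ∣? off₁ x - shear (quotient ∘ A∣)
  ...   | yes G∣ = yes (member (quotient ∘ A∣) (_∣_.equality ∘ A∣) G∣)
  ...   | no ¬G∣ = no λ m → ¬G∣ (subst (λ s → + G ∣ off₁ x - s) (shear-cong (quot-unique m A∣)) (G∣off₁-shear m))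

  L : Subsetℤ (2 +ℕ r)
  L x = does (member? x)

  ∈L⇒Member : ∀ {x} → x ∈ˢ L → Member x
  ∈L⇒Member {x} = dec-true⁻¹ (member? x)

  Member⇒∈L : ∀ {x} → Member x → x ∈ˢ L
  Member⇒∈L {x} = dec-true (member? x)

  Member-const : ∀ a → Member (λ _ → a)
  Member-const a = member (λ _ → 0ℤ) (λ i → off-const a (Fin.suc (Fin.suc i))) (divides 0ℤ off₁-shear≡0)
    where
    off₁-shear≡0 : off₁ {r} (λ _ → a) - shear (λ _ → 0ℤ) ≡ 0ℤ
    off₁-shear≡0 = cong₂ _-_ (off-const {suc r} a (Fin.suc Fin.zero)) (shear-zero (λ _ → refl))

  Member-+ : ∀ {x y} → Member x → Member y → Member (x +ᵛ y)
  Member-+ {x} {y} (member qx x≡ x∣) (member qy y≡ y∣) =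
    member (λ i → qx i + qy i) off₂≡′ (subst (+ G ∣_) (sym head) (∣m∣n⇒∣m+n x∣ y∣))
    where
    off₂≡′ : ∀ i → off₂ (x +ᵛ y) i ≡ (qx i + qy i) * + A i
    off₂≡′ i = begin
      off₂ (x +ᵛ y) i           ≡⟨ off-+ x y _ ⟩
      off₂ x i + off₂ y i       ≡⟨ cong₂ _+_ (x≡ i) (y≡ i) ⟩
      qx i * + A i + qy i * + A i ≡⟨ ℤₚ.*-distribʳ-+ (+ A i) (qx i) (qy i) ⟨
      (qx i + qy i) * + A i     ∎
      where open ≡-Reasoning
    head : off₁ (x +ᵛ y) - shear (λ i → qx i + qy i) ≡ (off₁ x - shear qx) + (off₁ y - shear qy)
    head = begin
      off₁ (x +ᵛ y) - shear (λ i → qx i + qy i)        ≡⟨ cong₂ _-_ (off-+ x y _) (shear-+ qx qy) ⟩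
      (off₁ x + off₁ y) - (shear qx + shear qy)        ≡⟨ identity (off₁ x) (off₁ y) (shear qx) (shear qy) ⟩
      (off₁ x - shear qx) + (off₁ y - shear qy)        ∎
      where
      open ≡-Reasoning
      identity : ∀ a b s t → (a + b) - (s + t) ≡ (a - s) + (b - t)
      identity = solve-∀

  Member-neg : ∀ {x} → Member x → Member (-ᵛ x)
  Member-neg {x} (member q x≡ x∣) = member (λ i → - q i) off₂≡′ (subst (+ G ∣_) (sym head) (∣m⇒∣-m x∣))
    where
    off₂≡′ : ∀ i → off₂ (-ᵛ x) i ≡ - q i * + A i
    off₂≡′ i = trans (off-neg x _) (trans (cong -_ (x≡ i)) (ℤₚ.neg-distribˡ-* (q i) (+ A i)))
    head : off₁ (-ᵛ x) - shear (λ i → - q i) ≡ - (off₁ x - shear q)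
    head = begin
      off₁ (-ᵛ x) - shear (λ i → - q i)             ≡⟨ cong₂ _-_ (off-neg x _) (shear-cong (λ i → sym (ℤₚ.-1*i≡-i (q i)))) ⟩
      - off₁ x - shear (λ i → -1ℤ * q i)            ≡⟨ cong (λ s → - off₁ x - s) (shear-*ˡ -1ℤ q) ⟩
      - off₁ x - -1ℤ * shear q                      ≡⟨ identity (off₁ x) (shear q) ⟩
      - (off₁ x - shear q)                          ∎
      where
      open ≡-Reasoning
      identity : ∀ a s → - a - -1ℤ * s ≡ - (a - s)
      identity = solve-∀

  G-generator : Vecℤ (2 +ℕ r)
  G-generator = cons₂ 0ℤ (+ G) (λ _ → 0ℤ)

  Member-G-generator : Member G-generator
  Member-G-generator = member (λ _ → 0ℤ) (λ _ → refl) (divides 1ℤ head)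
    where
    head : off₁ G-generator - shear (λ _ → 0ℤ) ≡ 1ℤ * + G
    head = trans (cong₂ _-_ (off-cons₂ {r} (+ G) (λ _ → 0ℤ) (Fin.suc Fin.zero)) (shear-zero (λ _ → refl)))
                 (trans (ℤₚ.+-identityʳ (+ G)) (sym (ℤₚ.*-identityˡ (+ G))))

  generator : Fin r → Vecℤ (2 +ℕ r)
  generator i = cons₂ 0ℤ (D * k i) (λ j → unit i j * + A j)

  off-generator : ∀ i c → off (generator i) c ≡ generator i c
  off-generator i = off-cons₂ (D * k i) (λ j → unit i j * + A j)

  Member-generator : ∀ i → Member (generator i)
  Member-generator i = member (unit i) (λ j → off-generator i (Fin.suc (Fin.suc j))) (divides 0ℤ head)
    where
    head : off₁ (generator i) - shear (unit i) ≡ 0ℤ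
    head = begin
      off₁ (generator i) - shear (unit i)     ≡⟨ cong₂ _-_ (off-generator i (Fin.suc Fin.zero)) (cong (D *_) (∑-unit k i)) ⟩
      D * k i - D * k i                       ≡⟨ ℤₚ.+-inverseʳ (D * k i) ⟩
      0ℤ                                      ∎
      where open ≡-Reasoning

  module _ (G∣D² : + G ∣ D * D) (G∣DA : ∀ i → + G ∣ D * + A i) where

    G∣shear*shear : ∀ (q q' : Fin r → ℤ) → + G ∣ shear q * shear q'
    G∣shear*shear q q' =
      subst (+ G ∣_) (sym (identity D (∑[ i < r ] (k i * q i)) (∑[ i < r ] (k i * q' i))))
            (∣m⇒∣m*n (∑[ i < r ] (k i * q i) * ∑[ i < r ] (k i * q' i)) G∣D²)
      where identity : ∀ d a b → (d * a) * (d * b) ≡ (d * d) * (a * b)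
            identity = solve-∀

    G∣shear-*A : ∀ (q : Fin r → ℤ) → + G ∣ shear (λ i → q i * + A i)
    G∣shear-*A q = subst (+ G ∣_) (sym (*-distribˡ-sum D (λ i → k i * (q i * + A i))))
                          (∑-∣ (λ i → D * (k i * (q i * + A i))) G∣term)
      where
      identity : ∀ d a κ x → d * (κ * (x * a)) ≡ (d * a) * (κ * x)
      identity = solve-∀
      G∣term : ∀ i → + G ∣ D * (k i * (q i * + A i))
      G∣term i = subst (+ G ∣_) (sym (identity D (+ A i) (k i) (q i))) (∣m⇒∣m*n (k i * q i) (G∣DA i))

    quot-* : ∀ {x y} → Member x → Member y → Fin r → ℤ
    quot-* {x} {y} mx my i = x Fin.zero * quot my i + y Fin.zero * quot mx i + quot mx i * quot my i * + A i

    off₂-* : ∀ {x y} (mx : Member x) (my : Member y) i → off₂ (x *ᵛ y) i ≡ quot-* mx my i * + A i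
    off₂-* {x} {y} mx my i = begin
      off₂ (x *ᵛ y) i
        ≡⟨ off-* x y _ ⟩
      x₀ * off₂ y i + y₀ * off₂ x i + off₂ x i * off₂ y i
        ≡⟨ cong₂ (λ a b → x₀ * b + y₀ * a + a * b) (off₂≡ mx i) (off₂≡ my i) ⟩
      x₀ * (qy * + A i) + y₀ * (qx * + A i) + (qx * + A i) * (qy * + A i)
        ≡⟨ identity x₀ y₀ qx qy (+ A i) ⟩
      quot-* mx my i * + A i
        ∎
      where
      open ≡-Reasoning
      x₀ = x Fin.zero
      y₀ = y Fin.zero
      qx = quot mx i
      qy = quot my i
      identity : ∀ x₀ y₀ a b c → x₀ * (b * c) + y₀ * (a * c) + (a * c) * (b * c)
                               ≡ (x₀ * b + y₀ * a + a * b * c) * c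
      identity = solve-∀

    G∣off₁-shear-* : ∀ {x y} (mx : Member x) (my : Member y) → + G ∣ off₁ (x *ᵛ y) - shear (quot-* mx my)
    G∣off₁-shear-* {x} {y} mx my = subst (+ G ∣_) (sym head)
      (∣m∣n⇒∣m-n (∣m∣n⇒∣m+n (∣m∣n⇒∣m+n (∣m∣n⇒∣m+n (∣m∣n⇒∣m+n
        (∣n⇒∣m*n x₀ (G∣off₁-shear my))
        (∣n⇒∣m*n y₀ (G∣off₁-shear mx)))
        (∣m⇒∣m*n (off₁ y) (G∣off₁-shear mx)))
        (∣n⇒∣m*n Sx (G∣off₁-shear my)))
        (G∣shear*shear (quot mx) (quot my)))
        (G∣shear-*A (λ i → quot mx i * quot my i)))
      where
      open ≡-Reasoning
      x₀ = x Fin.zero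
      y₀ = y Fin.zero
      Sx = shear (quot mx)
      Sy = shear (quot my)
      T = shear (λ i → quot mx i * quot my i * + A i)
      shear-quot-* : shear (quot-* mx my) ≡ x₀ * Sy + y₀ * Sx + T
      shear-quot-* = begin
        shear (quot-* mx my)
          ≡⟨ shear-+ _ _ ⟩
        shear (λ i → x₀ * quot my i + y₀ * quot mx i) + T
          ≡⟨ cong (_+ T) (shear-+ _ _) ⟩
        shear (λ i → x₀ * quot my i) + shear (λ i → y₀ * quot mx i) + T
          ≡⟨ cong₂ (λ a b → a + b + T) (shear-*ˡ x₀ (quot my)) (shear-*ˡ y₀ (quot mx)) ⟩
        x₀ * Sy + y₀ * Sx + T
          ∎
      identity : ∀ x₀ y₀ a b s t u → x₀ * b + y₀ * a + a * b - (x₀ * t + y₀ * s + u)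
                                   ≡ x₀ * (b - t) + y₀ * (a - s) + (a - s) * b + s * (b - t) + s * t - u
      identity = solve-∀
      head : off₁ (x *ᵛ y) - shear (quot-* mx my)
           ≡ x₀ * (off₁ y - Sy) + y₀ * (off₁ x - Sx) + (off₁ x - Sx) * off₁ y + Sx * (off₁ y - Sy) + Sx * Sy - T
      head = begin
        off₁ (x *ᵛ y) - shear (quot-* mx my)   ≡⟨ cong₂ _-_ (off-* x y _) shear-quot-* ⟩
        x₀ * off₁ y + y₀ * off₁ x + off₁ x * off₁ y - (x₀ * Sy + y₀ * Sx + T)
                                               ≡⟨ identity x₀ y₀ (off₁ x) (off₁ y) Sx Sy T ⟩
        x₀ * (off₁ y - Sy) + y₀ * (off₁ x - Sx) + (off₁ x - Sx) * off₁ y + Sx * (off₁ y - Sy) + Sx * Sy - T ∎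

    Member-* : ∀ {x y} → Member x → Member y → Member (x *ᵛ y)
    Member-* mx my = member (quot-* mx my) (off₂-* mx my) (G∣off₁-shear-* mx my)

    isSubring : IsSubringℤⁿ (2 +ℕ r) L
    isSubring = record
      { zero-mem   = Member⇒∈L (Member-const 0ℤ)
      ; one-mem    = Member⇒∈L (Member-const 1ℤ)
      ; +-closed   = λ _ _ x∈ y∈ → Member⇒∈L (Member-+ (∈L⇒Member x∈) (∈L⇒Member y∈))
      ; neg-closed = λ _ x∈ → Member⇒∈L (Member-neg (∈L⇒Member x∈))
      ; *-closed   = λ _ _ x∈ y∈ → Member⇒∈L (Member-* (∈L⇒Member x∈) (∈L⇒Member y∈))
      }

  module _ {p : ℕ} (p∣G : + p ∣ + G) (p∣D : + p ∣ D) (p∣A : ∀ i → + p ∣ + A i) where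

    p∣off : ∀ {x} → Member x → ∀ c → + p ∣ off x c
    p∣off {x} _ Fin.zero = divides 0ℤ (ℤₚ.+-inverseʳ (x Fin.zero))
    p∣off {x} (member q _ x∣) (Fin.suc Fin.zero) =
      subst (+ p ∣_) (identity (off₁ x) (shear q))
            (∣m∣n⇒∣m+n (∣-trans p∣G x∣) (∣m⇒∣m*n (∑[ i < r ] (k i * q i)) p∣D))
      where identity : ∀ a s → a - s + s ≡ a
            identity = solve-∀
    p∣off (member q x≡ _) (Fin.suc (Fin.suc i)) = subst (+ p ∣_) (sym (x≡ i)) (∣n⇒∣m*n (q i) (p∣A i))

    isIrreducible : IsIrreducible (2 +ℕ r) p L
    isIrreducible x x∈ i j = ∣⇒∣ᵤ (subst (+ p ∣_) (identity (x i) (x j) (x Fin.zero))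
                                   (∣m∣n⇒∣m-n (p∣off m i) (p∣off m j)))
      where
      m = ∈L⇒Member x∈
      identity : ∀ a b c → a - c - (b - c) ≡ a - b
      identity = solve-∀

  module _ .{{G≢0 : NonZero G}} where

    Residue : Set
    Residue = Fin G × Digits A

    ρ : Residue → Vecℤ (2 +ℕ r)
    ρ (c , d) = cons₂ 0ℤ (+ toℕ c) (λ i → + toℕ (digit d i))

    off-ρ : ∀ t c → off (ρ t) c ≡ ρ t c
    off-ρ (c , d) = off-cons₂ (+ toℕ c) (λ i → + toℕ (digit d i))

    reduce : ∀ x → ∃ λ t → Member (x -ᵛ ρ t)
    reduce x = t , member q off₂≡′ G∣head
      where
      q : Fin r → ℤ
      q i = (off₂ x i /ℕ A i) {{A≢0 i}}
      d : (i : Fin r) → Fin (A i)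
      d i = Fin.fromℕ< (n%ℕd<d (off₂ x i) (A i) {{A≢0 i}})
      h = off₁ x - shear q
      c = Fin.fromℕ< (n%ℕd<d h G)
      t = c , digits d
      off₂≡′ : ∀ i → off₂ (x -ᵛ ρ t) i ≡ q i * + A i
      off₂≡′ i = begin
        off₂ (x -ᵛ ρ t) i
          ≡⟨ off-- x (ρ t) (Fin.suc (Fin.suc i)) ⟩
        off₂ x i - off₂ (ρ t) i
          ≡⟨ cong (λ j → off₂ x i - j) (off-ρ t (Fin.suc (Fin.suc i))) ⟩
        off₂ x i - + toℕ (digit (digits d) i)
          ≡⟨ cong (λ j → off₂ x i - + toℕ j) (digit-digits d i) ⟩
        off₂ x i - + toℕ (d i)
          ≡⟨ cong (λ j → off₂ x i - + j) (Finₚ.toℕ-fromℕ< _) ⟩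
        off₂ x i - + ((off₂ x i %ℕ A i) {{A≢0 i}})
          ≡⟨ a-a%ℕd≡[a/ℕd]*d (off₂ x i) (A i) {{A≢0 i}} ⟩
        q i * + A i
          ∎
        where open ≡-Reasoning
      G∣head : + G ∣ off₁ (x -ᵛ ρ t) - shear q
      G∣head = divides (h /ℕ G) (begin
        off₁ (x -ᵛ ρ t) - shear q
          ≡⟨ cong (λ j → j - shear q) (off-- x (ρ t) (Fin.suc Fin.zero)) ⟩
        off₁ x - off₁ (ρ t) - shear q
          ≡⟨ cong (λ j → off₁ x - j - shear q) (off-ρ t (Fin.suc Fin.zero)) ⟩
        off₁ x - + toℕ c - shear q
          ≡⟨ identity (off₁ x) (+ toℕ c) (shear q) ⟩
        h - + toℕ c
          ≡⟨ cong (λ j → h - + j) (Finₚ.toℕ-fromℕ< _) ⟩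
        h - + (h %ℕ G)
          ≡⟨ a-a%ℕd≡[a/ℕd]*d h G ⟩
        (h /ℕ G) * + G
          ∎)
        where
        open ≡-Reasoning
        identity : ∀ a b s → a - b - s ≡ a - s - b
        identity = solve-∀

    separate : ∀ t t' → Member (ρ t -ᵛ ρ t') → t ≡ t'
    separate t@(c , d) t'@(c' , d') (member q ρ≡ G∣ρ) = cong₂ _,_ (Finₚ.toℕ-injective c≡c') d≡d'
      where
      off-ρ-ρ : ∀ j → off (ρ t -ᵛ ρ t') j ≡ ρ t j - ρ t' j
      off-ρ-ρ j = trans (off-- (ρ t) (ρ t') j) (cong₂ _-_ (off-ρ t j) (off-ρ t' j))
      digit≡ : ∀ i → toℕ (digit d i) ≡ toℕ (digit d' i)
      digit≡ i = ∣-<⇒≡ (Finₚ.toℕ<n _) (Finₚ.toℕ<n _)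
                      (divides (q i) (trans (sym (off-ρ-ρ (Fin.suc (Fin.suc i)))) (ρ≡ i)))
      d≡d' : d ≡ d'
      d≡d' = digit-injective (λ i → Finₚ.toℕ-injective (digit≡ i))
      q≡0 : ∀ i → q i ≡ 0ℤ
      q≡0 i = ℤₚ.*-cancelʳ-≡ (q i) 0ℤ (+ A i) {{A≢0 i}} (begin
        q i * + A i                                  ≡⟨ ρ≡ i ⟨
        off₂ (ρ t -ᵛ ρ t') i                         ≡⟨ off-ρ-ρ (Fin.suc (Fin.suc i)) ⟩
        + toℕ (digit d i) - + toℕ (digit d' i)       ≡⟨ cong (λ j → + j - + toℕ (digit d' i)) (digit≡ i) ⟩
        + toℕ (digit d' i) - + toℕ (digit d' i)      ≡⟨ ℤₚ.+-inverseʳ (+ toℕ (digit d' i)) ⟩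
        0ℤ                                           ∎)
        where open ≡-Reasoning
      c≡c' : toℕ c ≡ toℕ c'
      c≡c' = ∣-<⇒≡ (Finₚ.toℕ<n c) (Finₚ.toℕ<n c') (subst (+ G ∣_) head G∣ρ)
        where
        head : off₁ (ρ t -ᵛ ρ t') - shear q ≡ + toℕ c - + toℕ c'
        head = trans (cong₂ _-_ (off-ρ-ρ (Fin.suc Fin.zero)) (shear-zero q≡0)) (ℤₚ.+-identityʳ _)

    hasIndex : HasIndex (2 +ℕ r) L (G *ℕ ∏ A)
    hasIndex = hasIndex-via {L = L} (↔-trans Finₚ.*↔× (↔-refl ×-↔ Fin-∏↔Digits A)) ρ
                            (λ x → map₂ Member⇒∈L (reduce x))
                            (λ t t' → separate t t' ∘ ∈L⇒Member)


module Inclusion {r} (G : ℕ) (A : Fin r → ℕ) (D : ℤ) (k : Fin r → ℤ) (A≢0 : ∀ i → NonZero (A i))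
                 (G' : ℕ) (A' : Fin r → ℕ) (D' : ℤ) (k' : Fin r → ℤ) (A'≢0 : ∀ i → NonZero (A' i))
                 (L⊆L' : ∀ {x} → Lattice.Member G A D k A≢0 x → Lattice.Member G' A' D' k' A'≢0 x) where

  open Lattice G A D k A≢0 using (G-generator; Member-G-generator; generator; off-generator; Member-generator)
  open Lattice G' A' D' k' A'≢0 using (quot; off₂≡; G∣off₁-shear) renaming (shear-cong to shear'-cong; shear-zero to shear'-zero)

  G'∣G : G' ℕ∣.∣ G
  G'∣G = ∣⇒∣ᵤ (subst (+ G' ∣_) head (G∣off₁-shear m))
    where
    m = L⊆L' Member-G-generator
    head : off₁ G-generator - Lattice.shear G' A' D' k' A'≢0 (quot m) ≡ + G
    head = trans (cong₂ _-_ (off-cons₂ {r} (+ G) (λ _ → 0ℤ) (Fin.suc Fin.zero))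
                            (shear'-zero (λ i → ℤₚ.*-cancelʳ-≡ _ 0ℤ (+ A' i) {{A'≢0 i}} (sym (off₂≡ m i)))))
                 (ℤₚ.+-identityʳ (+ G))

  A'∣A : ∀ i → A' i ℕ∣.∣ A i
  A'∣A i = ∣⇒∣ᵤ (divides (quot m i) (begin
    + A i                   ≡⟨ ℤₚ.*-identityˡ (+ A i) ⟨
    1ℤ * + A i              ≡⟨ cong (_* + A i) (unit-diag i) ⟨
    unit i i * + A i        ≡⟨ off-generator i (Fin.suc (Fin.suc i)) ⟨
    off₂ (generator i) i    ≡⟨ off₂≡ m i ⟩
    quot m i * + A' i       ∎))
    where
    open ≡-Reasoning
    m = L⊆L' (Member-generator i)

  congruent : (∀ i → A i ≡ A' i) → ∀ i → + G' ∣ D * k i - D' * k' i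
  congruent A≡A' i = subst (+ G' ∣_) head (G∣off₁-shear m)
    where
    m = L⊆L' (Member-generator i)
    quot≡unit : ∀ j → quot m j ≡ unit i j
    quot≡unit j = ℤₚ.*-cancelʳ-≡ (quot m j) (unit i j) (+ A' j) {{A'≢0 j}} (begin
      quot m j * + A' j      ≡⟨ off₂≡ m j ⟨
      off₂ (generator i) j   ≡⟨ off-generator i (Fin.suc (Fin.suc j)) ⟩
      unit i j * + A j       ≡⟨ cong (λ a → unit i j * + a) (A≡A' j) ⟩
      unit i j * + A' j      ∎)
      where open ≡-Reasoning
    head : off₁ (generator i) - Lattice.shear G' A' D' k' A'≢0 (quot m) ≡ D * k i - D' * k' i
    head = cong₂ _-_ (off-generator i (Fin.suc Fin.zero))
                     (trans (shear'-cong quot≡unit) (cong (D' *_) (∑-unit k' i)))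

-- Weak compositions

suc-head : ∀ {m} → Vec ℕ (suc m) → Vec ℕ (suc m)
suc-head (h ∷ t) = suc h ∷ t

compositions : (m X : ℕ) → List (Vec ℕ m)
compositions zero    zero    = [] ∷ []
compositions zero    (suc X) = []
compositions (suc m) zero    = map (0 ∷_) (compositions m zero)
compositions (suc m) (suc X) = map suc-head (compositions (suc m) X) ++ map (0 ∷_) (compositions m (suc X))

compositions-unique : ∀ m X → Unique (compositions m X)
compositions-unique zero    zero    = [] ∷ []
compositions-unique zero    (suc X) = []
compositions-unique (suc m) zero    = Uniqueₚ.map⁺ Vecₚ.∷-injectiveʳ (compositions-unique m zero)
compositions-unique (suc m) (suc X) =
  Uniqueₚ.++⁺ (Uniqueₚ.map⁺ suc-head-injective (compositions-unique (suc m) X))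
              (Uniqueₚ.map⁺ Vecₚ.∷-injectiveʳ (compositions-unique m (suc X)))
              heads-differ
  where
  suc-head-injective : ∀ {v w : Vec ℕ (suc m)} → suc-head v ≡ suc-head w → v ≡ w
  suc-head-injective {_ ∷ _} {_ ∷ _} refl = refl
  heads-differ : ∀ {v} → ¬ (v ∈ map suc-head (compositions (suc m) X) × v ∈ map (0 ∷_) (compositions m (suc X)))
  heads-differ (v∈₁ , v∈₂) with ∈-map⁻ suc-head v∈₁ | ∈-map⁻ (0 ∷_) v∈₂
  ... | _ ∷ _ , _ , refl | _ , _ , ()

∈-compositions⁻ : ∀ {m X z} → z ∈ compositions m X → Vec.sum z ≡ X
∈-compositions⁻ {zero}  {zero}  (here refl) = refl
∈-compositions⁻ {suc m} {zero}  z∈ with ∈-map⁻ (0 ∷_) z∈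
... | _ , w∈ , refl = ∈-compositions⁻ w∈
∈-compositions⁻ {suc m} {suc X} z∈ with ∈-++⁻ (map suc-head (compositions (suc m) X)) z∈
... | inj₁ z∈₁ with ∈-map⁻ suc-head z∈₁
...   | _ ∷ _ , w∈ , refl = cong suc (∈-compositions⁻ w∈)
∈-compositions⁻ {suc m} {suc X} z∈ | inj₂ z∈₂ with ∈-map⁻ (0 ∷_) z∈₂
...   | _ , w∈ , refl = ∈-compositions⁻ w∈

∈-compositions⁺ : ∀ {m} (z : Vec ℕ m) → z ∈ compositions m (Vec.sum z)
∈-compositions⁺ []      = here refl
∈-compositions⁺ (h ∷ t) = cons h (∈-compositions⁺ t)
  where
  cons : ∀ {m X} h {t : Vec ℕ m} → t ∈ compositions m X → (h ∷ t) ∈ compositions (suc m) (h +ℕ X)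
  cons {X = zero}  zero    t∈ = ∈-map⁺ (0 ∷_) t∈
  cons {X = suc X} zero    t∈ = ∈-++⁺ʳ _ (∈-map⁺ (0 ∷_) t∈)
  cons             (suc h) t∈ = ∈-++⁺ˡ (∈-map⁺ suc-head (cons h t∈))

length-compositions-zero : ∀ m → length (compositions m zero) ≡ 1
length-compositions-zero zero    = refl
length-compositions-zero (suc m) = trans (Listₚ.length-map (0 ∷_) (compositions m zero)) (length-compositions-zero m)

length-compositions-suc : ∀ m X → length (compositions (suc m) (suc X))
                                ≡ length (compositions (suc m) X) +ℕ length (compositions m (suc X))
length-compositions-suc m X = begin
  length (map suc-head (compositions (suc m) X) ++ map (0 ∷_) (compositions m (suc X)))
    ≡⟨ Listₚ.length-++ (map suc-head (compositions (suc m) X)) ⟩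
  length (map suc-head (compositions (suc m) X)) +ℕ length (map (0 ∷_) (compositions m (suc X)))
    ≡⟨ cong₂ _+ℕ_ (Listₚ.length-map suc-head (compositions (suc m) X)) (Listₚ.length-map (0 ∷_) (compositions m (suc X))) ⟩
  length (compositions (suc m) X) +ℕ length (compositions m (suc X)) ∎
  where open ≡-Reasoning

length-compositions : ∀ r X → length (compositions (suc r) X) ≡ (X +ℕ r) C r
length-compositions r zero = trans (length-compositions-zero (suc r)) (sym (nCn≡1 r))
length-compositions zero (suc X) =
  trans (length-compositions-suc 0 X) (trans (ℕₚ.+-identityʳ _) (length-compositions zero X))
length-compositions (suc r) (suc X) = begin
  length (compositions (2 +ℕ r) (suc X))
    ≡⟨ length-compositions-suc (suc r) X ⟩
  length (compositions (2 +ℕ r) X) +ℕ length (compositions (suc r) (suc X))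
    ≡⟨ cong₂ _+ℕ_ (length-compositions (suc r) X) (length-compositions r (suc X)) ⟩
  (X +ℕ suc r) C suc r +ℕ (suc X +ℕ r) C r
    ≡⟨ cong (λ N → N C suc r +ℕ (suc X +ℕ r) C r) (ℕₚ.+-suc X r) ⟩
  (suc X +ℕ r) C suc r +ℕ (suc X +ℕ r) C r
    ≡⟨ ℕₚ.+-comm ((suc X +ℕ r) C suc r) _ ⟩
  (suc X +ℕ r) C r +ℕ (suc X +ℕ r) C suc r
    ≡⟨ nCk+nC[k+1]≡[n+1]C[k+1] (suc X +ℕ r) r ⟩
  suc (suc X +ℕ r) C suc r
    ≡⟨ cong (_C suc r) (ℕₚ.+-suc (suc X) r) ⟨
  (suc X +ℕ suc r) C suc r
    ∎
  where open ≡-Reasoning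

infix 4 _≤ᵛ_ _≤ᵛ?_
infixl 6 _⊕_ _⊖ᵛ_

_≤ᵛ_ : ∀ {m} → Vec ℕ m → Vec ℕ m → Set
_≤ᵛ_ = Pointwise _≤_

_≤ᵛ?_ : ∀ {m} (b y : Vec ℕ m) → Dec (b ≤ᵛ y)
_≤ᵛ?_ = Pointwise.decidable ℕₚ._≤?_

_⊕_ : ∀ {m} → Vec ℕ m → Vec ℕ m → Vec ℕ m
_⊕_ = Vec.zipWith _+ℕ_

_⊖ᵛ_ : ∀ {m} → Vec ℕ m → Vec ℕ m → Vec ℕ m
_⊖ᵛ_ = Vec.zipWith _∸_

sum-⊕ : ∀ {m} (b z : Vec ℕ m) → Vec.sum (b ⊕ z) ≡ Vec.sum b +ℕ Vec.sum z
sum-⊕ []      []      = refl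
sum-⊕ (x ∷ b) (y ∷ z) = trans (cong (x +ℕ y +ℕ_) (sum-⊕ b z)) (identity x y (Vec.sum b) (Vec.sum z))
  where identity : ∀ a b c d → a +ℕ b +ℕ (c +ℕ d) ≡ a +ℕ c +ℕ (b +ℕ d)
        identity = ℕsolve-∀

≤ᵛ-⊕ : ∀ {m} (b z : Vec ℕ m) → b ≤ᵛ b ⊕ z
≤ᵛ-⊕ []      []      = []
≤ᵛ-⊕ (x ∷ b) (y ∷ z) = ℕₚ.m≤m+n x y ∷ ≤ᵛ-⊕ b z

⊕-⊖ᵛ : ∀ {m} {b y : Vec ℕ m} → b ≤ᵛ y → b ⊕ (y ⊖ᵛ b) ≡ y
⊕-⊖ᵛ []           = refl
⊕-⊖ᵛ (x≤y ∷ b≤y) = cong₂ _∷_ (ℕₚ.m+[n∸m]≡n x≤y) (⊕-⊖ᵛ b≤y)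

⊕-cancelˡ : ∀ {m} (b : Vec ℕ m) {z z'} → b ⊕ z ≡ b ⊕ z' → z ≡ z'
⊕-cancelˡ []      {[]}    {[]}      _  = refl
⊕-cancelˡ (x ∷ b) {_ ∷ _} {_ ∷ _} eq =
  cong₂ _∷_ (ℕₚ.+-cancelˡ-≡ x _ _ (Vecₚ.∷-injectiveˡ eq)) (⊕-cancelˡ b (Vecₚ.∷-injectiveʳ eq))

sum-mono-≤ᵛ : ∀ {m} {b y : Vec ℕ m} → b ≤ᵛ y → Vec.sum b ≤ Vec.sum y
sum-mono-≤ᵛ []           = z≤n
sum-mono-≤ᵛ (x≤y ∷ b≤y) = ℕₚ.+-mono-≤ x≤y (sum-mono-≤ᵛ b≤y)

above : ∀ {m} → Vec ℕ m → ℕ → List (Vec ℕ m)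
above b X = filter (b ≤ᵛ?_) (compositions _ X)

module _ {m} (b : Vec ℕ m) (X : ℕ) where

  above-unique : Unique (above b X)
  above-unique = AllPairsₚ.filter⁺ (b ≤ᵛ?_) (compositions-unique m X)

  ∈-above⁻ : ∀ {y} → y ∈ above b X → b ≤ᵛ y × Vec.sum y ≡ X
  ∈-above⁻ y∈ = let (y∈c , b≤y) = ∈-filter⁻ (b ≤ᵛ?_) y∈ in b≤y , ∈-compositions⁻ y∈c

  ∈-above⁺ : ∀ {y} → b ≤ᵛ y → Vec.sum y ≡ X → y ∈ above b X
  ∈-above⁺ {y} b≤y refl = ∈-filter⁺ (b ≤ᵛ?_) (∈-compositions⁺ y) b≤y

  length-above : Vec.sum b ≤ X → length (above b X) ≡ length (compositions m (X ∸ Vec.sum b))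
  length-above Σb≤X = begin
    length (above b X)                                 ≡⟨ unique∧set⇒length≡ above-unique shifted-unique (mk⇔ to from) ⟩
    length (map (b ⊕_) (compositions m (X ∸ Vec.sum b))) ≡⟨ Listₚ.length-map (b ⊕_) (compositions m (X ∸ Vec.sum b)) ⟩
    length (compositions m (X ∸ Vec.sum b))            ∎
    where
    open ≡-Reasoning
    shifted-unique : Unique (map (b ⊕_) (compositions m (X ∸ Vec.sum b)))
    shifted-unique = Uniqueₚ.map⁺ (⊕-cancelˡ b) (compositions-unique m (X ∸ Vec.sum b))
    to : ∀ {y} → y ∈ above b X → y ∈ map (b ⊕_) (compositions m (X ∸ Vec.sum b))
    to {y} y∈ with ∈-above⁻ y∈
    ... | b≤y , refl = subst (_∈ map (b ⊕_) (compositions m (Vec.sum y ∸ Vec.sum b))) (⊕-⊖ᵛ b≤y)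
                             (∈-map⁺ (b ⊕_) (subst (λ s → y ⊖ᵛ b ∈ compositions m s) Σz≡ (∈-compositions⁺ (y ⊖ᵛ b))))
      where
      Σz≡ : Vec.sum (y ⊖ᵛ b) ≡ Vec.sum y ∸ Vec.sum b
      Σz≡ = trans (sym (ℕₚ.m+n∸m≡n (Vec.sum b) _))
                  (cong (_∸ Vec.sum b) (trans (sym (sum-⊕ b (y ⊖ᵛ b))) (cong Vec.sum (⊕-⊖ᵛ b≤y))))
    from : ∀ {y} → y ∈ map (b ⊕_) (compositions m (X ∸ Vec.sum b)) → y ∈ above b X
    from y∈ with ∈-map⁻ (b ⊕_) y∈
    ... | z , z∈ , refl = ∈-above⁺ (≤ᵛ-⊕ b z)
                            (trans (sum-⊕ b z) (trans (cong (Vec.sum b +ℕ_) (∈-compositions⁻ z∈)) (ℕₚ.m+[n∸m]≡n Σb≤X)))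

  above-empty : X < Vec.sum b → above b X ≡ []
  above-empty X<Σb = Listₚ.filter-none (b ≤ᵛ?_) (All.tabulate λ {y} y∈ b≤y →
    ℕₚ.<⇒≱ X<Σb (subst (Vec.sum b ≤_) (∈-compositions⁻ y∈) (sum-mono-≤ᵛ b≤y)))

binomℤ-⊖-≥ : ∀ {X c} k → c ≤ X → binomℤ (X ⊖ c) k ≡ (X ∸ c) C k
binomℤ-⊖-≥ k c≤X = cong (λ z → binomℤ z k) (ℤₚ.⊖-≥ c≤X)

binomℤ-⊖-< : ∀ {X c} k → X < c → binomℤ (X ⊖ c) k ≡ 0
binomℤ-⊖-< {X} {suc c} k (s≤s X≤c) =
  cong (λ z → binomℤ z k) (trans (ℤₚ.⊖-< (s≤s X≤c)) (cong (λ d → - + d) (ℕₚ.+-∸-assoc 1 X≤c)))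

length-above-binomℤ : ∀ {r} (b : Vec ℕ (suc r)) X c → Vec.sum b ≡ c +ℕ r →
                      length (above b X) ≡ binomℤ (X ⊖ c) r
length-above-binomℤ {r} b X c Σb≡c+r with c +ℕ r ℕₚ.≤? X
... | yes c+r≤X = begin
  length (above b X)                          ≡⟨ length-above b X (subst (_≤ X) (sym Σb≡c+r) c+r≤X) ⟩
  length (compositions (suc r) (X ∸ Vec.sum b)) ≡⟨ length-compositions r (X ∸ Vec.sum b) ⟩
  (X ∸ Vec.sum b +ℕ r) C r                     ≡⟨ cong (λ s → (X ∸ s +ℕ r) C r) Σb≡c+r ⟩
  (X ∸ (c +ℕ r) +ℕ r) C r                      ≡⟨ cong (λ s → (s +ℕ r) C r) (ℕₚ.∸-+-assoc X c r) ⟨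
  (X ∸ c ∸ r +ℕ r) C r                         ≡⟨ cong (_C r) (ℕₚ.m∸n+n≡m r≤X∸c) ⟩
  (X ∸ c) C r                                  ≡⟨ binomℤ-⊖-≥ r (ℕₚ.≤-trans (ℕₚ.m≤m+n c r) c+r≤X) ⟨
  binomℤ (X ⊖ c) r                             ∎
  where
  open ≡-Reasoning
  r≤X∸c : r ≤ X ∸ c
  r≤X∸c = subst (_≤ X ∸ c) (ℕₚ.m+n∸m≡n c r) (ℕₚ.∸-monoˡ-≤ c c+r≤X)
... | no c+r≰X = trans (cong length (above-empty b X (subst (X <_) (sym Σb≡c+r) (ℕₚ.≰⇒> c+r≰X))))
                       (sym (binomℤ-vanishes (c ℕₚ.≤? X)))
  where
  binomℤ-vanishes : Dec (c ≤ X) → binomℤ (X ⊖ c) r ≡ 0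
  binomℤ-vanishes (yes c≤X) = trans (binomℤ-⊖-≥ r c≤X) (k>n⇒nCk≡0 X∸c<r)
    where
    X∸c<r : X ∸ c < r
    X∸c<r = ℕₚ.+-cancelˡ-< c _ _ (subst (_< c +ℕ r) (sym (ℕₚ.m+[n∸m]≡n c≤X)) (ℕₚ.≰⇒> c+r≰X))
  binomℤ-vanishes (no c≰X) = binomℤ-⊖-< r (ℕₚ.≰⇒> c≰X)

-- Levels

sum-replicate : ∀ n x → Vec.sum (Vec.replicate n x) ≡ n *ℕ x
sum-replicate zero    x = refl
sum-replicate (suc n) x = cong (x +ℕ_) (sum-replicate n x)

≤ᵛ-replicate : ∀ {n x y} → x ≤ y → Vec.replicate n x ≤ᵛ Vec.replicate n y
≤ᵛ-replicate {zero}  x≤y = []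
≤ᵛ-replicate {suc n} x≤y = x≤y ∷ ≤ᵛ-replicate x≤y

module Levels (r e : ℕ) where

  bound : ℕ → Vec ℕ (suc r)
  bound j = suc (2 *ℕ j) ∷ Vec.replicate r (suc j)

  sum-bound : ∀ j → Vec.sum (bound j) ≡ suc ((2 +ℕ r) *ℕ j) +ℕ r
  sum-bound j = trans (cong (suc (2 *ℕ j) +ℕ_) (sum-replicate r (suc j))) (identity j r)
    where identity : ∀ j r → suc (2 *ℕ j) +ℕ r *ℕ suc j ≡ suc ((2 +ℕ r) *ℕ j) +ℕ r
          identity = ℕsolve-∀

  bound-mono : ∀ {j j'} → j ≤ j' → bound j ≤ᵛ bound j'
  bound-mono j≤j' = s≤s (ℕₚ.*-monoʳ-≤ 2 j≤j') ∷ ≤ᵛ-replicate (s≤s j≤j')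

  atLeast : ℕ → List (Vec ℕ (suc r))
  atLeast j = above (bound j) e

  -- y ∈ exactly j iff j is the largest level whose bound y dominates
  exactly : ℕ → List (Vec ℕ (suc r))
  exactly j = filter (∁? (bound (suc j) ≤ᵛ?_)) (atLeast j)

  binomial : ℕ → ℕ
  binomial j = binomℤ (+ e - + 1 - + ((2 +ℕ r) *ℕ j)) r

  length-atLeast : ∀ j → length (atLeast j) ≡ binomial j
  length-atLeast j =
    trans (length-above-binomℤ (bound j) e (suc c) (sum-bound j)) (cong (λ z → binomℤ z r) (sym e-1-c≡))
    where
    c = (2 +ℕ r) *ℕ j
    e-1-c≡ : + e - + 1 - + c ≡ e ⊖ suc c
    e-1-c≡ = begin
      + e - + 1 - + c          ≡⟨ ℤₚ.+-assoc (+ e) (- + 1) (- + c) ⟩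
      + e + (- + 1 + - + c)    ≡⟨ cong (λ z → + e + z) (ℤₚ.neg-distrib-+ (+ 1) (+ c)) ⟨
      + e - + suc c            ≡⟨ ℤₚ.m-n≡m⊖n e (suc c) ⟩
      e ⊖ suc c                ∎
      where open ≡-Reasoning

  length-exactly : ∀ j → length (exactly j) +ℕ length (atLeast (suc j)) ≡ length (atLeast j)
  length-exactly j = begin
    length (exactly j) +ℕ length (atLeast (suc j))
      ≡⟨ cong (λ ys → length (exactly j) +ℕ length ys)
              (filter-filter-⊆ (bound (suc j) ≤ᵛ?_) (bound j ≤ᵛ?_) bound-weaken (compositions (suc r) e)) ⟨
    length (exactly j) +ℕ length (filter (bound (suc j) ≤ᵛ?_) (atLeast j))
      ≡⟨ length-filter-split (bound (suc j) ≤ᵛ?_) (atLeast j) ⟩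
    length (atLeast j) ∎
    where
    open ≡-Reasoning
    bound-weaken : ∀ {y} → bound (suc j) ≤ᵛ y → bound j ≤ᵛ y
    bound-weaken = Pointwise.trans ℕₚ.≤-trans (bound-mono (ℕₚ.n≤1+n j))

  length-exactly-binomial : ∀ j → + length (exactly j) ≡ + binomial j - + binomial (suc j)
  length-exactly-binomial j = begin
    + length (exactly j)
      ≡⟨ identity (+ length (exactly j)) (+ N) ⟩
    + length (exactly j) + + N - + N
      ≡⟨ cong (λ z → z - + N) (ℤₚ.pos-+ (length (exactly j)) N) ⟨
    + (length (exactly j) +ℕ N) - + N
      ≡⟨ cong (λ z → + z - + N) (length-exactly j) ⟩
    + length (atLeast j) - + N
      ≡⟨ cong₂ (λ A B → + A - + B) (length-atLeast j) (length-atLeast (suc j)) ⟩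
    + binomial j - + binomial (suc j)
      ∎
    where
    open ≡-Reasoning
    N = length (atLeast (suc j))
    identity : ∀ a b → a ≡ a + b - b
    identity = solve-∀

  exactly-unique : ∀ j → Unique (exactly j)
  exactly-unique j = AllPairsₚ.filter⁺ _ (above-unique (bound j) e)

  ∈-exactly⁻ : ∀ {j y} → y ∈ exactly j → bound j ≤ᵛ y × ¬ bound (suc j) ≤ᵛ y × Vec.sum y ≡ e
  ∈-exactly⁻ {j} y∈ with ∈-filter⁻ (∁? (bound (suc j) ≤ᵛ?_)) y∈
  ... | y∈atLeast , ¬above = let (b≤y , Σy≡e) = ∈-above⁻ (bound j) e y∈atLeast in b≤y , ¬above , Σy≡e

  level-unique : ∀ {j j' y} → y ∈ exactly j → y ∈ exactly j' → j ≡ j'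
  level-unique y∈ y∈' = ℕₚ.≤-antisym (ℕₚ.≮⇒≥ (not-below y∈' y∈)) (ℕₚ.≮⇒≥ (not-below y∈ y∈'))
    where
    not-below : ∀ {j j' y} → y ∈ exactly j → y ∈ exactly j' → ¬ j < j'
    not-below y∈ y∈' j<j' =
      proj₁ (proj₂ (∈-exactly⁻ y∈)) (Pointwise.trans ℕₚ.≤-trans (bound-mono j<j') (proj₁ (∈-exactly⁻ y∈')))

bounded : (r N : ℕ) → List (Vec ℕ r)
bounded zero    N = [] ∷ []
bounded (suc r) N = cartesianProductWith _∷_ (upTo N) (bounded r N)

length-bounded : ∀ r N → length (bounded r N) ≡ N ^ℕ r
length-bounded zero    N = refl
length-bounded (suc r) N = trans (length-cartesianProductWith _∷_ (upTo N) (bounded r N))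
                                 (cong₂ _*ℕ_ (Listₚ.length-upTo N) (length-bounded r N))

bounded-unique : ∀ r N → Unique (bounded r N)
bounded-unique zero    N = [] ∷ []
bounded-unique (suc r) N = Uniqueₚ.cartesianProductWith⁺ _∷_ Vecₚ.∷-injective (Uniqueₚ.upTo⁺ N) (bounded-unique r N)

∈-bounded⁻ : ∀ {r N k} → k ∈ bounded r N → ∀ i → Vec.lookup k i < N
∈-bounded⁻ {suc r} {N} k∈ i with ∈-cartesianProductWith⁻ _∷_ (upTo N) (bounded r N) k∈
∈-bounded⁻ k∈ Fin.zero    | _ , _ , h∈ , _  , refl = ∈-upTo⁻ h∈
∈-bounded⁻ k∈ (Fin.suc i) | _ , _ , _  , t∈ , refl = ∈-bounded⁻ t∈ i

-- Lattices with prime-power parameters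

module Powers (P : ℕ) (1<P : 1 < P) where

  instance
    P≢0 : NonZero P
    P≢0 = ℕ.>-nonZero (ℕₚ.<-trans ℕ.z<s 1<P)

  ^≢0 : ∀ a → NonZero (P ^ℕ a)
  ^≢0 a = ℕₚ.m^n≢0 P a

  ^-injective : ∀ {m n} → P ^ℕ m ≡ P ^ℕ n → m ≡ n
  ^-injective {m} {n} eq with ℕₚ.<-cmp m n
  ... | tri< m<n _ _ = contradiction eq (ℕₚ.<⇒≢ (ℕₚ.^-monoʳ-< P 1<P m<n))
  ... | tri≈ _ m≡n _ = m≡n
  ... | tri> _ _ n<m = contradiction (sym eq) (ℕₚ.<⇒≢ (ℕₚ.^-monoʳ-< P 1<P n<m))

  +^-+ : ∀ m n → + (P ^ℕ (m +ℕ n)) ≡ + (P ^ℕ m) * + (P ^ℕ n)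
  +^-+ m n = trans (cong +_ (ℕₚ.^-distribˡ-+-* P m n)) (ℤₚ.pos-* (P ^ℕ m) (P ^ℕ n))

  +^-∣ : ∀ {m n} → m ≤ n → + (P ^ℕ m) ∣ + (P ^ℕ n)
  +^-∣ {m} {n} m≤n = divides (+ (P ^ℕ (n ∸ m)))
    (trans (cong (λ l → + (P ^ℕ l)) (sym (ℕₚ.m∸n+n≡m m≤n))) (+^-+ (n ∸ m) m))

  ∏-^ : ∀ {r} (a : Vec ℕ r) → ∏ (λ i → P ^ℕ Vec.lookup a i) ≡ P ^ℕ Vec.sum a
  ∏-^ []      = refl
  ∏-^ (x ∷ a) = trans (cong (P ^ℕ x *ℕ_) (∏-^ a)) (sym (ℕₚ.^-distribˡ-+-* P x (Vec.sum a)))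

  P∣^ : ∀ {n} → 1 ≤ n → + P ∣ + (P ^ℕ n)
  P∣^ {n} 1≤n = subst (_∣ + (P ^ℕ n)) (cong +_ (ℕₚ.*-identityʳ P)) (+^-∣ 1≤n)

  module PowerLattice {r} (j g : ℕ) (a k : Vec ℕ r) =
    Lattice (P ^ℕ g) (λ i → P ^ℕ Vec.lookup a i) (+ (P ^ℕ (g ∸ j))) (λ i → + Vec.lookup k i) (λ i → ^≢0 (Vec.lookup a i))

  powerLattice-irreducibleSubring : ∀ {r e j g} {a k : Vec ℕ r} → 2 *ℕ j < g → (∀ i → j < Vec.lookup a i) →
                                    g +ℕ Vec.sum a ≡ e →
                                    IrredSubringOfIndex (2 +ℕ r) P (P ^ℕ e) (PowerLattice.L j g a k)
  powerLattice-irreducibleSubring {r} {e} {j} {g} {a} {k} 2j<g j<a g+Σa≡e =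
      isSubring G∣D² G∣DA
    , index
    , isIrreducible (P∣^ 1≤g) (P∣^ (ℕₚ.≤-trans (s≤s z≤n) j<s)) (λ i → P∣^ (ℕₚ.≤-trans (s≤s z≤n) (j<a i)))
    where
    open PowerLattice j g a k
    s = g ∸ j
    j+j<g : j +ℕ j < g
    j+j<g = subst (_< g) (cong (j +ℕ_) (ℕₚ.+-identityʳ j)) 2j<g
    1≤g : 1 ≤ g
    1≤g = ℕₚ.≤-trans (s≤s z≤n) j+j<g
    s+j≡g : s +ℕ j ≡ g
    s+j≡g = ℕₚ.m∸n+n≡m (ℕₚ.≤-trans (ℕₚ.m≤m+n j j) (ℕₚ.<⇒≤ j+j<g))
    j<s : j < s
    j<s = ℕₚ.+-cancelʳ-< j j s (subst (j +ℕ j <_) (sym s+j≡g) j+j<g)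
    G∣D² : + (P ^ℕ g) ∣ + (P ^ℕ s) * + (P ^ℕ s)
    G∣D² = subst (_ ∣_) (+^-+ s s) (+^-∣ (subst (_≤ s +ℕ s) s+j≡g (ℕₚ.+-monoʳ-≤ s (ℕₚ.<⇒≤ j<s))))
    G∣DA : ∀ i → + (P ^ℕ g) ∣ + (P ^ℕ s) * + (P ^ℕ Vec.lookup a i)
    G∣DA i = subst (_ ∣_) (+^-+ s _) (+^-∣ (subst (_≤ s +ℕ Vec.lookup a i) s+j≡g (ℕₚ.+-monoʳ-≤ s (ℕₚ.<⇒≤ (j<a i)))))
    index≡ : P ^ℕ g *ℕ ∏ (λ i → P ^ℕ Vec.lookup a i) ≡ P ^ℕ e
    index≡ = begin
      P ^ℕ g *ℕ ∏ (λ i → P ^ℕ Vec.lookup a i) ≡⟨ cong (P ^ℕ g *ℕ_) (∏-^ a) ⟩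
      P ^ℕ g *ℕ P ^ℕ Vec.sum a                ≡⟨ ℕₚ.^-distribˡ-+-* P g (Vec.sum a) ⟨
      P ^ℕ (g +ℕ Vec.sum a)                   ≡⟨ cong (P ^ℕ_) g+Σa≡e ⟩
      P ^ℕ e                                  ∎
      where open ≡-Reasoning
    index : HasIndex (2 +ℕ r) L (P ^ℕ e)
    index = subst (HasIndex (2 +ℕ r) L) index≡ (hasIndex {{^≢0 g}})

  module PowerInclusion {r} (j g : ℕ) (a k : Vec ℕ r) (j' g' : ℕ) (a' k' : Vec ℕ r)
                        (L⊆L' : ∀ {x} → PowerLattice.Member j g a k x → PowerLattice.Member j' g' a' k' x) =
    Inclusion (P ^ℕ g) (λ i → P ^ℕ Vec.lookup a i) (+ (P ^ℕ (g ∸ j))) (λ i → + Vec.lookup k i) (λ i → ^≢0 (Vec.lookup a i))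
              (P ^ℕ g') (λ i → P ^ℕ Vec.lookup a' i) (+ (P ^ℕ (g' ∸ j'))) (λ i → + Vec.lookup k' i) (λ i → ^≢0 (Vec.lookup a' i))
              L⊆L'

  module _ {r} {j g j' g'} {a k a' k' : Vec ℕ r} (L≐L' : ∀ x → PowerLattice.L j g a k x ≡ PowerLattice.L j' g' a' k' x) where

    private
      module ⊆ = PowerInclusion j g a k j' g' a' k'
        (λ m → PowerLattice.∈L⇒Member j' g' a' k' (trans (sym (L≐L' _)) (PowerLattice.Member⇒∈L j g a k m)))
      module ⊇ = PowerInclusion j' g' a' k' j g a k
        (λ m → PowerLattice.∈L⇒Member j g a k (trans (L≐L' _) (PowerLattice.Member⇒∈L j' g' a' k' m)))

    powerLattice-shape : g ≡ g' × a ≡ a'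
    powerLattice-shape = ^-injective (ℕ∣.∣-antisym ⊇.G'∣G ⊆.G'∣G)
                       , lookup-ext (λ i → ^-injective (ℕ∣.∣-antisym (⊇.A'∣A i) (⊆.A'∣A i)))

  powerLattice-coefficients : ∀ {r j g} {a k k' : Vec ℕ r} → j ≤ g →
                              (∀ i → Vec.lookup k i < P ^ℕ j) → (∀ i → Vec.lookup k' i < P ^ℕ j) →
                              (∀ x → PowerLattice.L j g a k x ≡ PowerLattice.L j g a k' x) → k ≡ k'
  powerLattice-coefficients {r} {j} {g} {a} {k} {k'} j≤g k<P^j k'<P^j L≐L' = lookup-ext λ i →
    ∣-<⇒≡ (k<P^j i) (k'<P^j i) (*-cancelˡ-∣ (+ (P ^ℕ s)) {{^≢0 s}} (subst₂ _∣_ G≡ D-distrib (⊆.congruent (λ _ → refl) i)))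
    where
    s = g ∸ j
    module ⊆ = PowerInclusion j g a k j g a k'
      (λ m → PowerLattice.∈L⇒Member j g a k' (trans (sym (L≐L' _)) (PowerLattice.Member⇒∈L j g a k m)))
    G≡ : + (P ^ℕ g) ≡ + (P ^ℕ s) * + (P ^ℕ j)
    G≡ = trans (cong (λ l → + (P ^ℕ l)) (sym (ℕₚ.m∸n+n≡m j≤g))) (+^-+ s j)
    D-distrib : ∀ {i} → + (P ^ℕ s) * + Vec.lookup k i - + (P ^ℕ s) * + Vec.lookup k' i
                      ≡ + (P ^ℕ s) * (+ Vec.lookup k i - + Vec.lookup k' i)
    D-distrib {i} = identity (+ (P ^ℕ s)) (+ Vec.lookup k i) (+ Vec.lookup k' i)
      where identity : ∀ d a b → d * a - d * b ≡ d * (a - b)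
            identity = solve-∀

-- The family of subrings

module Family (P : ℕ) (1<P : 1 < P) (r e : ℕ) where

  open Levels r e
  open Powers P 1<P

  Parameters : Set
  Parameters = ℕ × Vec ℕ (suc r) × Vec ℕ r

  block : (j : ℕ) → List (Vec ℕ (suc r) × Vec ℕ r)
  block j = cartesianProduct (exactly j) (bounded r (P ^ℕ j))

  tagged-block : ℕ → List Parameters
  tagged-block j = map (j ,_) (block j)

  levels : List ℕ
  levels = map suc (upTo (e / (2 +ℕ r)))

  parameters : List Parameters
  parameters = tagged block levels

  Admissible : Parameters → Set
  Admissible (j , y , k) = y ∈ exactly j × k ∈ bounded r (P ^ℕ j)

  lattice : Parameters → Subsetℤ (2 +ℕ r)
  lattice (j , g ∷ a , k) = PowerLattice.L j g a k

  parameters-admissible : All Admissible parameters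
  parameters-admissible = Allₚ.concat⁺ (Allₚ.map⁺ (All.universal block-admissible levels))
    where
    block-admissible : ∀ j → All Admissible (tagged-block j)
    block-admissible j = Allₚ.map⁺ (All.tabulate (λ yk∈ → ∈-cartesianProduct⁻ (exactly j) (bounded r (P ^ℕ j)) yk∈))

  parameters-unique : Unique parameters
  parameters-unique = tagged-unique block (Uniqueₚ.map⁺ ℕₚ.suc-injective (Uniqueₚ.upTo⁺ (e / (2 +ℕ r))))
                                    (λ j → Uniqueₚ.cartesianProduct⁺ (exactly-unique j) (bounded-unique r (P ^ℕ j)))

  lattice-irreducibleSubring : ∀ {c} → Admissible c → IrredSubringOfIndex (2 +ℕ r) P (P ^ℕ e) (lattice c)
  lattice-irreducibleSubring {j , g ∷ a , k} (y∈ , _) with ∈-exactly⁻ y∈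
  ... | 2j<g ∷ j<a , _ , Σy≡e =
    powerLattice-irreducibleSubring {a = a} {k} 2j<g
      (λ i → subst (_≤ Vec.lookup a i) (Vecₚ.lookup-replicate i (suc j)) (Pointwise.lookup j<a i)) Σy≡e

  lattice-injective : ∀ {c c'} → Admissible c → Admissible c' → (∀ x → lattice c x ≡ lattice c' x) → c ≡ c'
  lattice-injective {j , g ∷ a , k} {j' , g' ∷ a' , k'} (y∈ , k∈) (y∈' , k∈') L≐L'
    with powerLattice-shape {j = j} {g} {j'} {g'} {a} {k} {a'} {k'} L≐L'
  ... | refl , refl with level-unique y∈ y∈'
  ...   | refl = cong (λ k → j , g ∷ a , k) (powerLattice-coefficients {a = a} j≤g (∈-bounded⁻ k∈) (∈-bounded⁻ k∈') L≐L')
    where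
    j≤g : j ≤ g
    j≤g with ∈-exactly⁻ y∈
    ... | 2j<g ∷ _ , _ = ℕₚ.≤-trans (ℕₚ.m≤m+n j _) (ℕₚ.<⇒≤ 2j<g)

  term≡length : ∀ j → term P (2 +ℕ r) e j ≡ + length (tagged-block j)
  term≡length j = begin
    + (P ^ℕ (r *ℕ j)) * (+ binomial j - + binomial (suc j))
      ≡⟨ cong (+ (P ^ℕ (r *ℕ j)) *_) (length-exactly-binomial j) ⟨
    + (P ^ℕ (r *ℕ j)) * + length (exactly j)
      ≡⟨ ℤₚ.pos-* (P ^ℕ (r *ℕ j)) (length (exactly j)) ⟨
    + (P ^ℕ (r *ℕ j) *ℕ length (exactly j))
      ≡⟨ cong +_ (ℕₚ.*-comm (P ^ℕ (r *ℕ j)) (length (exactly j))) ⟩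
    + (length (exactly j) *ℕ P ^ℕ (r *ℕ j))
      ≡⟨ cong (λ z → + (length (exactly j) *ℕ z)) (trans (cong (P ^ℕ_) (ℕₚ.*-comm r j)) (sym (ℕₚ.^-*-assoc P j r))) ⟩
    + (length (exactly j) *ℕ (P ^ℕ j) ^ℕ r)
      ≡⟨ cong (λ z → + (length (exactly j) *ℕ z)) (length-bounded r (P ^ℕ j)) ⟨
    + (length (exactly j) *ℕ length (bounded r (P ^ℕ j)))
      ≡⟨ cong +_ (length-cartesianProductWith _,_ (exactly j) (bounded r (P ^ℕ j))) ⟨
    + length (block j)
      ≡⟨ cong +_ (Listₚ.length-map (j ,_) (block j)) ⟨
    + length (tagged-block j)
      ∎
    where open ≡-Reasoning

  lowerBound≡length : lowerBound P (2 +ℕ r) e ≡ + length parameters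
  lowerBound≡length = sum-terms (upTo (e / (2 +ℕ r)))
    where
    sum-terms : ∀ is → foldr _+_ 0ℤ (map (λ i → term P (2 +ℕ r) e (suc i)) is) ≡ + length (tagged block (map suc is))
    sum-terms []       = refl
    sum-terms (i ∷ is) = begin
      term P (2 +ℕ r) e (suc i) + foldr _+_ 0ℤ (map (λ i → term P (2 +ℕ r) e (suc i)) is)
        ≡⟨ cong₂ _+_ (term≡length (suc i)) (sum-terms is) ⟩
      + length (tagged-block (suc i)) + + length (tagged block (map suc is))
        ≡⟨ ℤₚ.pos-+ (length (tagged-block (suc i))) _ ⟨
      + (length (tagged-block (suc i)) +ℕ length (tagged block (map suc is)))
        ≡⟨ cong +_ (Listₚ.length-++ (tagged-block (suc i))) ⟨
      + length (tagged block (map suc (i ∷ is)))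
        ∎
      where open ≡-Reasoning

  irreducibleSubrings : Σ (List (Subsetℤ (2 +ℕ r))) λ Ls →
                        All (IrredSubringOfIndex (2 +ℕ r) P (P ^ℕ e)) Ls × AllPairs Distinct Ls ×
                        lowerBound P (2 +ℕ r) e ≤ℤ + length Ls
  irreducibleSubrings =
      map lattice parameters
    , Allₚ.map⁺ (All.map lattice-irreducibleSubring parameters-admissible)
    , AllPairsₚ.map⁺ (pairs-of-unique (λ adm adm' c≢c' L≐L' → c≢c' (lattice-injective adm adm' L≐L'))
                                      parameters-admissible parameters-unique)
    , ℤₚ.≤-reflexive (trans lowerBound≡length (cong +_ (sym (Listₚ.length-map lattice parameters))))

theorem7p6 : (p n e : ℕ) → Prime p → 2 ≤ n → 1 ≤ e →
    Σ (List (Subsetℤ n)) λ Ls →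
      All (IrredSubringOfIndex n p (p Data.Nat.^ e)) Ls ×
      AllPairs Distinct Ls ×
      lowerBound p n e ≤ℤ + (length Ls)
theorem7p6 p (suc (suc r)) e p-prime _ _ =
  Family.irreducibleSubrings p (ℕ.nonTrivial⇒n>1 p {{prime⇒nonTrivial p-prime}}) r e
theorem7p6 p 1 e _ (s≤s ()) _
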